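{- Let $T$ be a tree and $H$ a graph, and let the vertex set of $T(H)$ be partitioned into two classes. Let $L \subseteq V(H)$ with $|L|=t$. Suppose there are two copies $H_1$ and $H_2$ of $H$ in $T(H)$ such that for each $u \in L$, the copies of $u$ in $H_1$ and in $H_2$ belong to distinct partition classes. Then $T(H)$ has a matching of size $t$ in which the two ends of each edge lie in different partition classes.
   Context: For a tree $T$ and a graph $H$, $T(H)$ is the graph consisting of pairwise disjoint copies of $H$, one copy $H_t$ for each vertex $t$ of $T$, with the edges of each copy, and, for each edge $\{t_1,t_2\}$ of $T$ and each vertex $w$ of $H$, an edge joining the copy of $w$ in $H_{t_1}$ to the copy of $w$ in $H_{t_2}$. -}

module Defs where

open import Data.Nat using (ℕ; _≤_)
open import Data.Fin using (Fin)
open import Data.Bool using (Bool)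
open import Data.List using (List; []; _∷_; _++_; head; last; length; concatMap)
open import Data.List.Relation.Unary.All using (All)
open import Data.List.Relation.Unary.Unique.Propositional using (Unique)
open import Data.Maybe using (just)
open import Data.Product using (_×_; _,_; ∃; Σ)
open import Data.Sum using (_⊎_; inj₁; inj₂)
open import Data.Unit using (⊤)
open import Relation.Nullary using (¬_)
open import Relation.Binary.PropositionalEquality using (_≡_; refl; sym)

record Graph (V : Set) : Set₁ where
  field
    Adj    : V → V → Set
    adj-sym    : ∀ {x y} → Adj x y → Adj y x
    adj-irrefl : ∀ {x} → ¬ Adj x x
open Graph public

module _ {V : Set} (G : Graph V) where

  Chain : List V → Set
  Chain []           = ⊤
  Chain (x ∷ [])     = ⊤
  Chain (x ∷ y ∷ vs) = Adj G x y × Chain (y ∷ vs)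

  Connected : Set
  Connected = ∀ x y → ∃ λ (vs : List V) →
    Chain vs × head vs ≡ just x × last vs ≡ just y

  IsCycle : V → List V → Set
  IsCycle x rest = 2 ≤ length rest × Unique (x ∷ rest) × Chain (x ∷ rest ++ x ∷ [])

  Acyclic : Set
  Acyclic = ∀ x rest → ¬ IsCycle x rest

  endpoints : List (V × V) → List V
  endpoints = concatMap (λ { (x , y) → x ∷ y ∷ [] })

  IsMatching : List (V × V) → Set
  IsMatching M = All (λ { (x , y) → Adj G x y }) M × Unique (endpoints M)

FinGraph : ℕ → Set₁
FinGraph n = Graph (Fin n)

IsTree : ∀ {n} → FinGraph n → Set
IsTree T = Connected T × Acyclic T

-- T(H): vertex (s , w) is the copy of w in H_s
treeProd : ∀ {m k} → FinGraph m → FinGraph k → Graph (Fin m × Fin k)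
Adj (treeProd T H) (s , w) (s′ , w′) = (s ≡ s′ × Adj H w w′) ⊎ (Adj T s s′ × w ≡ w′)
adj-sym (treeProd T H) (inj₁ (e , a)) = inj₁ (sym e , adj-sym H a)
adj-sym (treeProd T H) (inj₂ (a , e)) = inj₂ (adj-sym T a , sym e)
adj-irrefl (treeProd T H) (inj₁ (_ , a)) = adj-irrefl H a
adj-irrefl (treeProd T H) (inj₂ (a , _)) = adj-irrefl T a

module Submission where

open import Defs
open import Data.Nat using (ℕ; suc)
open import Data.Fin using (Fin; zero; suc)
open import Data.Fin.Properties using (suc-injective)
open import Data.Fin.Subset using (Subset; _∈_; ∣_∣; inside; outside)
open import Data.Bool using (Bool)
open import Data.Bool.Properties using () renaming (_≟_ to _≟ᵇ_)
open import Data.Empty using (⊥-elim)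
open import Data.List using (List; []; _∷_; map; length; last)
open import Data.List.Properties using (length-map)
open import Data.List.Membership.Propositional using () renaming (_∈_ to _∈ₗ_)
open import Data.List.Membership.Propositional.Properties using (∈-map⁻)
open import Data.List.Relation.Unary.All as All using (All; []; _∷_)
open import Data.List.Relation.Unary.All.Properties as All using ()
open import Data.List.Relation.Unary.Any using (here; there)
open import Data.List.Relation.Unary.AllPairs using ([]; _∷_)
open import Data.List.Relation.Unary.Unique.Propositional using (Unique)
open import Data.List.Relation.Unary.Unique.Propositional.Properties as Unique using ()
open import Data.Maybe using (just)
open import Data.Product using (_×_; _,_; ∃; ∃₂; proj₁; proj₂)
open import Data.Sum using (inj₂)
open import Data.Vec using ([]; _∷_; here; there)
open import Function using (_∘_)
open import Relation.Binary.Definitions using (DecidableEquality)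
open import Relation.Binary.PropositionalEquality using (_≡_; _≢_; refl; trans; cong)
open import Relation.Nullary using (yes; no)

-- For u ∈ L the copy of u changes colour along a walk from s₁ to s₂ in T (only the
-- connectivity of T matters), so some edge {x , y} of T has (x , u) and (y , u)
-- coloured differently. These "vertical" edges
-- lie in pairwise distinct layers V(T) × {u}, hence form a matching of size |L|.

members : ∀ {k} → Subset k → List (Fin k)
members []            = []
members (inside ∷ L)  = zero ∷ map suc (members L)
members (outside ∷ L) = map suc (members L)

length-members : ∀ {k} (L : Subset k) → length (members L) ≡ ∣ L ∣
length-members []            = refl
length-members (inside ∷ L)  = cong suc (trans (length-map suc (members L)) (length-members L))
length-members (outside ∷ L) = trans (length-map suc (members L)) (length-members L)

members⁻ : ∀ {k} (L : Subset k) {u} → u ∈ₗ members L → u ∈ L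
members⁻ (inside ∷ L) (here refl) = here
members⁻ (inside ∷ L) (there u∈) with ∈-map⁻ suc u∈
... | _ , v∈ , refl = there (members⁻ L v∈)
members⁻ (outside ∷ L) u∈ with ∈-map⁻ suc u∈
... | _ , v∈ , refl = there (members⁻ L v∈)

members-unique : ∀ {k} (L : Subset k) → Unique (members L)
members-unique []            = []
members-unique (inside ∷ L)  =
  All.map⁺ (All.universal (λ _ ()) (members L)) ∷ Unique.map⁺ suc-injective (members-unique L)
members-unique (outside ∷ L) = Unique.map⁺ suc-injective (members-unique L)

Crossing : ∀ {V A : Set} → Graph V → (V → A) → Set
Crossing G f = ∃₂ λ x y → Adj G x y × f x ≢ f y

module _ {V A : Set} (G : Graph V) (_≟_ : DecidableEquality A) (f : V → A) where

  walk-crossing : ∀ x vs {b} → Chain G (x ∷ vs) → last (x ∷ vs) ≡ just b →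
                  f x ≢ f b → Crossing G f
  walk-crossing x []       _         refl fx≢fb = ⊥-elim (fx≢fb refl)
  walk-crossing x (y ∷ vs) (xy , ch) end  fx≢fb with f x ≟ f y
  ... | no  fx≢fy = x , y , xy , fx≢fy
  ... | yes fx≡fy = walk-crossing y vs ch end (fx≢fb ∘ trans fx≡fy)

  connected-crossing : Connected G → ∀ a b → f a ≢ f b → Crossing G f
  connected-crossing conn a b fa≢fb with conn a b
  ... | x ∷ vs , ch , refl , end = walk-crossing x vs ch end fa≢fb

module Verticals {m k} (T : FinGraph m) (H : FinGraph k) (c : Fin m × Fin k → Bool) where

  Vertex : Set
  Vertex = Fin m × Fin k

  CrossingAt : Fin k → Set
  CrossingAt u = Crossing T (λ s → c (s , u))

  verticals : ∀ {us} → All CrossingAt us → List (Vertex × Vertex)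
  verticals []                            = []
  verticals {u ∷ _} ((x , y , _) ∷ cross) = ((x , u) , (y , u)) ∷ verticals cross

  length-verticals : ∀ {us} (cross : All CrossingAt us) → length (verticals cross) ≡ length us
  length-verticals []          = refl
  length-verticals (_ ∷ cross) = cong suc (length-verticals cross)

  verticals-bichromatic : ∀ {us} (cross : All CrossingAt us) →
                          All (λ e → c (proj₁ e) ≢ c (proj₂ e)) (verticals cross)
  verticals-bichromatic []                            = []
  verticals-bichromatic ((_ , _ , _ , cx≢cy) ∷ cross) = cx≢cy ∷ verticals-bichromatic cross

  endpoints-verticals-layers : ∀ {us} (cross : All CrossingAt us) →
                               All (λ p → proj₂ p ∈ₗ us) (endpoints (treeProd T H) (verticals cross))
  endpoints-verticals-layers []          = []
  endpoints-verticals-layers (_ ∷ cross) =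
    here refl ∷ here refl ∷ All.map there (endpoints-verticals-layers cross)

  verticals-matching : ∀ {us} → Unique us → (cross : All CrossingAt us) →
                       IsMatching (treeProd T H) (verticals cross)
  verticals-matching []            []                         = [] , []
  verticals-matching (u∉us ∷ uniq) ((x , y , xy , _) ∷ cross)
    with edges , distinct ← verticals-matching uniq cross =
    inj₂ (xy , refl) ∷ edges , (x≢y ∷ outside-layer x) ∷ outside-layer y ∷ distinct
    where
    x≢y : (x , _) ≢ (y , _)
    x≢y refl = adj-irrefl T xy

    outside-layer : ∀ z → All ((z , _) ≢_) (endpoints (treeProd T H) (verticals cross))
    outside-layer z = All.map (λ { u∈us refl → All.lookup u∉us u∈us refl })
                              (endpoints-verticals-layers cross)

lemma2 : ∀ {m k} (T : FinGraph m) (H : FinGraph k) → IsTree T →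
    (c : Fin m × Fin k → Bool) → (L : Subset k) → (t : ℕ) → ∣ L ∣ ≡ t →
    (s₁ s₂ : Fin m) → (∀ u → u ∈ L → c (s₁ , u) ≢ c (s₂ , u)) →
    ∃ λ (M : List ((Fin m × Fin k) × (Fin m × Fin k))) →
    length M ≡ t × IsMatching (treeProd T H) M ×
    All (λ e → c (proj₁ e) ≢ c (proj₂ e)) M
lemma2 T H (connected , _) c L t refl s₁ s₂ distinct-colours =
  verticals cross ,
  trans (length-verticals cross) (length-members L) ,
  verticals-matching (members-unique L) cross ,
  verticals-bichromatic cross
  where
  open Verticals T H c
  cross : All CrossingAt (members L)
  cross = All.tabulate λ {u} u∈ →
    connected-crossing T _≟ᵇ_ (λ s → c (s , u)) connected s₁ s₂ (distinct-colours u (members⁻ L u∈))
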